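{- For all integers $m,n\ge 0$ there is a bijection $$G:\mathcal{D}(m,n)\to \mathcal{D}^*(m,n)\cup\mathcal{D}^*(m-1,n-1)\cup\mathcal{D}^*(m-2,n-2).$$
   Context: A Schur partition is a partition of an integer into positive parts such that any two consecutive parts (in sorted order) differ by at least $3$, and no two consecutive parts differing by exactly $3$ are both multiples of $3$. For a partition $\pi$, let $m(\pi)$ denote the number of parts of $\pi$ plus the number of even parts of $\pi$. $\mathcal{D}(m,n)$ is the set of Schur partitions $\pi$ of $n$ with $m(\pi)=m$. $\mathcal{D}^*(m,n)$ is the subset of $\mathcal{D}(m,n)$ consisting of those partitions in which every odd part is $\ge 3$ and every even part is $\ge 6$. Sets with a negative index are empty. -}

module Defs where

open import Data.Nat using (ℕ; zero; suc; _+_; _∸_; _≤ᵇ_; _≡ᵇ_; _%_)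
open import Data.Bool using (Bool; true; false; _∧_; _∨_; not; T)
open import Data.List using (List; []; _∷_; length; filter)
open import Data.Nat.ListAction using (sum)
open import Data.Product using (Σ; _×_)
open import Data.Sum using (_⊎_)
open import Relation.Binary.PropositionalEquality using (_≡_)

-- A partition is represented as a list of its parts in strictly
-- decreasing order (largest part first).  Schur condition checked by a
-- boolean function, so that membership proofs are proof-irrelevant (T b).

isEven : ℕ → Bool
isEven n = n % 2 ≡ᵇ 0

isMult3 : ℕ → Bool
isMult3 n = n % 3 ≡ᵇ 0

goodPair : ℕ → ℕ → Bool
goodPair x y = ((y + 3) ≤ᵇ x) ∧ not ((x ≡ᵇ y + 3) ∧ isMult3 x ∧ isMult3 y)

isSchur : List ℕ → Bool
isSchur [] = true
isSchur (x ∷ []) = 1 ≤ᵇ x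
isSchur (x ∷ y ∷ r) = (1 ≤ᵇ x) ∧ goodPair x y ∧ isSchur (y ∷ r)

mStat : List ℕ → ℕ
mStat π = length π + length (filter (λ x → T? (isEven x)) π)
  where
  open import Relation.Nullary.Decidable using (Dec)
  open import Data.Bool.Properties using (T?)

isStar : List ℕ → Bool
isStar [] = true
isStar (x ∷ r) = (if isEven x then 6 ≤ᵇ x else 3 ≤ᵇ x) ∧ isStar r
  where open import Data.Bool using (if_then_else_)

D : ℕ → ℕ → Set
D m n = Σ (List ℕ) (λ π → T (isSchur π) × (sum π ≡ n) × (mStat π ≡ m))

D* : ℕ → ℕ → Set
D* m n = Σ (List ℕ) (λ π → T (isSchur π) × T (isStar π) × (sum π ≡ n) × (mStat π ≡ m))

-- D*(m-k, n-k) with the convention that it is empty when m-k or n-k is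
-- negative (as integers): require k ≤ m and k ≤ n.
D*shift : ℕ → ℕ → ℕ → Set
D*shift k m n = Σ (List ℕ) (λ π → T (k ≤ᵇ m) × T (k ≤ᵇ n) × T (isSchur π) × T (isStar π)
                                   × (sum π ≡ n ∸ k) × (mStat π ≡ m ∸ k))

Target : ℕ → ℕ → Set
Target m n = D* m n ⊎ (D*shift 1 m n ⊎ D*shift 2 m n)

-- At most two parts of a Schur partition lie below 5 (consecutive parts differ by at least 3), and
-- they form one of the tails [], [1], [2], [3], [4], [4,1]; every part ≥ 5 already satisfies the star
-- condition.  G keeps the parts ≥ 5 and replaces the tails [], [1], [2] by [] and the tails [3], [4],
-- [4,1] by [3]; this lowers both n and m by k = 0, 1, 2 respectively.  A part z ≥ 5 can precede any of
-- [], [1], [2], and it can precede 3 iff z ≥ 7 iff it can precede 4, so each replacement is reversible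
-- once k is known, and k is the summand of the target in which G π lies.

module Submission where

open import Defs
open import Algebra.Properties.CommutativeSemigroup using (interchange)
open import Data.Bool using (Bool; true; false; _∧_; T)
open import Data.Bool.Properties using (T-∧; T-irrelevant; ∧-assoc; ∧-zeroʳ)
open import Data.Empty using (⊥-elim)
open import Data.Fin using (Fin; zero; suc; toℕ)
open import Data.List using (List; []; _∷_; _++_; _∷ʳ_; length; filter)
open import Data.List.Properties using (++-identityʳ; ++-assoc; length-++; filter-++)
open import Data.List.Relation.Unary.All using (All; []; _∷_)
open import Data.Nat using (ℕ; suc; _+_; _∸_; _≤_; _≤ᵇ_; _≡ᵇ_; z≤n; s≤s)
open import Data.Nat.ListAction using (sum)
open import Data.Nat.ListAction.Properties using (sum-++)
open import Data.Nat.Properties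
open import Data.Product using (Σ; _×_; _,_; proj₁; proj₂; map₁)
open import Data.Sum using (_⊎_; inj₁; inj₂)
open import Data.Sum.Function.Propositional using (_⊎-↔_)
open import Function using (id)
open import Function.Bundles using (_⤖_; _⇔_; _↔_; mk⇔; mk↔ₛ′; Equivalence)
open import Function.Properties.Inverse using (↔-trans; ↔⇒⤖)
open import Relation.Nullary using (¬_; yes; no; contradiction)
open import Relation.Nullary.Irrelevant using (Irrelevant)
open import Relation.Binary.PropositionalEquality

open Equivalence using (to; from)

infixr 2 _×-irrelevant_

_×-irrelevant_ : ∀ {a b} {A : Set a} {B : Set b} → Irrelevant A → Irrelevant B → Irrelevant (A × B)
(irrA ×-irrelevant irrB) (a , b) (a′ , b′) = cong₂ _,_ (irrA a a′) (irrB b b′)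

Σ-≡-irrelevant : ∀ {A : Set} {P : A → Set} → (∀ x → Irrelevant (P x)) →
                 {u v : Σ A P} → proj₁ u ≡ proj₁ v → u ≡ v
Σ-≡-irrelevant irr {x , p} {.x , q} refl = cong (x ,_) (irr x p q)

module _ {A B : Set} {P : A → Set} {Q : B → Set}
         (P-irrelevant : ∀ x → Irrelevant (P x)) (Q-irrelevant : ∀ y → Irrelevant (Q y)) where

  Σ-restrict-↔ : (f : A → B) (g : B → A) →
                 (∀ {x} → P x → Q (f x)) → (∀ {y} → Q y → P (g y)) →
                 (∀ {x} → P x → g (f x) ≡ x) → (∀ {y} → Q y → f (g y) ≡ y) →
                 Σ A P ↔ Σ B Q
  Σ-restrict-↔ f g f-pres g-pres gf fg = mk↔ₛ′
    (λ (x , p) → f x , f-pres p)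
    (λ (y , q) → g y , g-pres q)
    (λ (_ , q) → Σ-≡-irrelevant Q-irrelevant (fg q))
    (λ (_ , p) → Σ-≡-irrelevant P-irrelevant (gf p))

Σ-cong-⇔ : ∀ {A : Set} {P Q : A → Set} → (∀ x → Irrelevant (P x)) → (∀ x → Irrelevant (Q x)) →
           (∀ x → P x ⇔ Q x) → Σ A P ↔ Σ A Q
Σ-cong-⇔ P-irr Q-irr P⇔Q =
  Σ-restrict-↔ P-irr Q-irr id id (λ {x} → to (P⇔Q x)) (λ {x} → from (P⇔Q x)) (λ _ → refl) (λ _ → refl)

Σ-Fin3-↔ : ∀ {A : Set} {P : Fin 3 × A → Set} →
           Σ (Fin 3 × A) P ↔ (Σ A (λ a → P (zero , a)) ⊎ (Σ A (λ a → P (suc zero , a)) ⊎ Σ A (λ a → P (suc (suc zero) , a))))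
Σ-Fin3-↔ = mk↔ₛ′
  (λ { ((zero , a) , p) → inj₁ (a , p)
     ; ((suc zero , a) , p) → inj₂ (inj₁ (a , p))
     ; ((suc (suc zero) , a) , p) → inj₂ (inj₂ (a , p)) })
  (λ { (inj₁ (a , p)) → (zero , a) , p
     ; (inj₂ (inj₁ (a , p))) → (suc zero , a) , p
     ; (inj₂ (inj₂ (a , p))) → (suc (suc zero) , a) , p })
  (λ { (inj₁ _) → refl ; (inj₂ (inj₁ _)) → refl ; (inj₂ (inj₂ _)) → refl })
  (λ { ((zero , _) , _) → refl ; ((suc zero , _) , _) → refl ; ((suc (suc zero) , _) , _) → refl })

+-≡⇔≡∸ : ∀ {a k n} → a + k ≡ n ⇔ (T (k ≤ᵇ n) × a ≡ n ∸ k)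
+-≡⇔≡∸ {a} {k} {n} = mk⇔
  (λ { refl → ≤⇒≤ᵇ (m≤n+m k a) , sym (m+n∸n≡m a k) })
  (λ (k≤n , a≡) → trans (cong (_+ k) a≡) (m∸n+n≡m (≤ᵇ⇒≤ k n k≤n)))

additive-++-shift : (f : List ℕ → ℕ) → (∀ l r → f (l ++ r) ≡ f l + f r) →
                    ∀ l {t t′ k} → f t ≡ f t′ + k → f (l ++ t) ≡ f (l ++ t′) + k
additive-++-shift f f-++ l {t} {t′} {k} eq = begin
  f (l ++ t)       ≡⟨ f-++ l t ⟩
  f l + f t        ≡⟨ cong (f l +_) eq ⟩
  f l + (f t′ + k) ≡⟨ +-assoc (f l) (f t′) k ⟨
  f l + f t′ + k   ≡⟨ cong (_+ k) (f-++ l t′) ⟨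
  f (l ++ t′) + k  ∎
  where open ≡-Reasoning

goodPair-gap : ∀ {x y} → T (goodPair x y) → 3 + y ≤ x
goodPair-gap {x} {y} h = subst (_≤ x) (+-comm y 3) (≤ᵇ⇒≤ (y + 3) x (proj₁ (to (T-∧ {y + 3 ≤ᵇ x}) h)))

goodPair-intro : ∀ {x y} → 3 + y ≤ x → (x ≡ 3 + y → isMult3 y ≡ false) → T (goodPair x y)
goodPair-intro {x} {y} gap tight with y + 3 ≤ᵇ x in e | x ≡ᵇ y + 3 in e′
... | false | _ = subst T e (≤⇒≤ᵇ (subst (_≤ x) (+-comm 3 y) gap))
... | true | false = _
... | true | true
  rewrite tight (trans (≡ᵇ⇒≡ x (y + 3) (subst T (sym e′) _)) (+-comm y 3)) | ∧-zeroʳ (isMult3 x) = _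

goodPair-wide : ∀ {x y} → 4 + y ≤ x → T (goodPair x y)
goodPair-wide {y = y} gap = goodPair-intro (≤-trans (n≤1+n (3 + y)) gap) λ { refl → ⊥-elim (1+n≰n gap) }

goodPair-nonMult3 : ∀ {x y} → isMult3 y ≡ false → 3 + y ≤ x → T (goodPair x y)
goodPair-nonMult3 nonMult3 gap = goodPair-intro gap λ _ → nonMult3

-- z = 6 is excluded because 6 and 3 are both multiples of 3.
goodPair-3⇒4 : ∀ z → T (goodPair z 3) → T (goodPair z 4)
goodPair-3⇒4 z h = goodPair-nonMult3 refl (≤∧≢⇒< (goodPair-gap {z} {3} h) λ { refl → h })

goodPair-4⇒3 : ∀ z → T (goodPair z 4) → T (goodPair z 3)
goodPair-4⇒3 z h = goodPair-wide (goodPair-gap {z} {4} h)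

data Schur : List ℕ → Set where
  []   : Schur []
  [_]  : ∀ {x} → T (1 ≤ᵇ x) → Schur (x ∷ [])
  link : ∀ {x y r} → T (1 ≤ᵇ x) → T (goodPair x y) → Schur (y ∷ r) → Schur (x ∷ y ∷ r)

isSchur⇒Schur : ∀ π → T (isSchur π) → Schur π
isSchur⇒Schur [] _ = []
isSchur⇒Schur (x ∷ []) p = [ p ]
isSchur⇒Schur (x ∷ y ∷ r) h =
  let (p , h′) = to (T-∧ {1 ≤ᵇ x}) h ; (g , s) = to (T-∧ {goodPair x y}) h′
  in link p g (isSchur⇒Schur (y ∷ r) s)

Schur⇒isSchur : ∀ {π} → Schur π → T (isSchur π)
Schur⇒isSchur [] = _
Schur⇒isSchur [ p ] = p
Schur⇒isSchur (link {x} {y} p g s) = from (T-∧ {1 ≤ᵇ x}) (p , from (T-∧ {goodPair x y}) (g , Schur⇒isSchur s))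

schur-head : ∀ {x r} → Schur (x ∷ r) → T (1 ≤ᵇ x)
schur-head [ p ] = p
schur-head (link p _ _) = p

schur-gap : ∀ {x y r} → Schur (x ∷ y ∷ r) → 3 + y ≤ x
schur-gap (link _ g _) = goodPair-gap g

schur-∷⁻ : ∀ {x r} → Schur (x ∷ r) → Schur r
schur-∷⁻ [ _ ] = []
schur-∷⁻ (link _ _ s) = s

schur-++⁻ˡ : ∀ l {r} → Schur (l ++ r) → Schur l
schur-++⁻ˡ [] _ = []
schur-++⁻ˡ (_ ∷ []) h = [ schur-head h ]
schur-++⁻ˡ (_ ∷ y ∷ l) (link p g s) = link p g (schur-++⁻ˡ (y ∷ l) s)

schur-∷ʳ-∷ : ∀ l {x r} → Schur (l ∷ʳ x) → Schur (x ∷ r) → Schur (l ++ x ∷ r)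
schur-∷ʳ-∷ [] _ s = s
schur-∷ʳ-∷ (_ ∷ []) (link p g _) s = link p g s
schur-∷ʳ-∷ (_ ∷ u ∷ l) (link p g h) s = link p g (schur-∷ʳ-∷ (u ∷ l) h s)

schur-∷ʳ-replace : ∀ l {x x′} → (∀ z → T (goodPair z x) → T (goodPair z x′)) →
                   T (1 ≤ᵇ x′) → Schur (l ∷ʳ x) → Schur (l ∷ʳ x′)
schur-∷ʳ-replace [] _ p _ = [ p ]
schur-∷ʳ-replace (_ ∷ []) f p′ (link p g _) = link p (f _ g) [ p′ ]
schur-∷ʳ-replace (_ ∷ u ∷ l) f p′ (link p g h) = link p g (schur-∷ʳ-replace (u ∷ l) f p′ h)

Big : List ℕ → Set
Big = All (5 ≤_)

schur-∷ʳ : ∀ l {x} → (∀ {z} → 5 ≤ z → T (goodPair z x)) →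
           T (1 ≤ᵇ x) → Big l → Schur l → Schur (l ∷ʳ x)
schur-∷ʳ [] _ p _ _ = [ p ]
schur-∷ʳ (_ ∷ []) f p (5≤z ∷ _) [ q ] = link q (f 5≤z) [ p ]
schur-∷ʳ (_ ∷ u ∷ l) f p (_ ∷ big) (link q g h) = link q g (schur-∷ʳ (u ∷ l) f p big h)

Star : List ℕ → Set
Star π = T (isStar π)

isStar-++ : ∀ l r → isStar (l ++ r) ≡ isStar l ∧ isStar r
isStar-++ [] r = refl
isStar-++ (x ∷ l) r = trans (cong (_ ∧_) (isStar-++ l r)) (sym (∧-assoc _ (isStar l) (isStar r)))

Star-++ : ∀ l r → Star (l ++ r) ⇔ (Star l × Star r)
Star-++ l r rewrite isStar-++ l r = T-∧

star-single : ∀ {x} → 5 ≤ x → Star (x ∷ [])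
star-single {0} ()
star-single {1} (s≤s ())
star-single {2} (s≤s (s≤s ()))
star-single {3} (s≤s (s≤s (s≤s ())))
star-single {4} (s≤s (s≤s (s≤s (s≤s ()))))
star-single {5} _ = _
star-single {suc (suc (suc (suc (suc (suc x)))))} _ with isEven (6 + x)
... | true = _
... | false = _

star-big : ∀ {l} → Big l → Star l
star-big [] = _
star-big {x ∷ l} (5≤x ∷ big) = from (Star-++ (x ∷ []) l) (star-single 5≤x , star-big big)

mStat-++ : ∀ l r → mStat (l ++ r) ≡ mStat l + mStat r
mStat-++ l r = begin
  length (l ++ r) + length (filter _ (l ++ r))
    ≡⟨ cong₂ _+_ (length-++ l) (trans (cong length (filter-++ _ l r)) (length-++ (filter _ l))) ⟩
  (length l + length r) + (length (filter _ l) + length (filter _ r))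
    ≡⟨ interchange +-commutativeSemigroup (length l) (length r) _ _ ⟩
  mStat l + mStat r ∎
  where open ≡-Reasoning

-- The parts below 5 of a Schur partition.  G replaces smallTail b k by smallTail b zero,
-- lowering n and m by k.
smallTail : Bool → Fin 3 → List ℕ
smallTail false zero             = []
smallTail false (suc zero)       = 1 ∷ []
smallTail false (suc (suc zero)) = 2 ∷ []
smallTail true  zero             = 3 ∷ []
smallTail true  (suc zero)       = 4 ∷ []
smallTail true  (suc (suc zero)) = 4 ∷ 1 ∷ []

smallTail-sum : ∀ b k → sum (smallTail b k) ≡ sum (smallTail b zero) + toℕ k
smallTail-sum false zero             = refl
smallTail-sum false (suc zero)       = refl
smallTail-sum false (suc (suc zero)) = refl
smallTail-sum true  zero             = refl
smallTail-sum true  (suc zero)       = refl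
smallTail-sum true  (suc (suc zero)) = refl

smallTail-mStat : ∀ b k → mStat (smallTail b k) ≡ mStat (smallTail b zero) + toℕ k
smallTail-mStat false zero             = refl
smallTail-mStat false (suc zero)       = refl
smallTail-mStat false (suc (suc zero)) = refl
smallTail-mStat true  zero             = refl
smallTail-mStat true  (suc zero)       = refl
smallTail-mStat true  (suc (suc zero)) = refl

smallTail-star : ∀ b → Star (smallTail b zero)
smallTail-star false = _
smallTail-star true  = _

smallTail-star⁻ : ∀ b k → Star (smallTail b k) → k ≡ zero
smallTail-star⁻ false zero _ = refl
smallTail-star⁻ true  zero _ = refl
smallTail-star⁻ false (suc zero) ()
smallTail-star⁻ false (suc (suc zero)) ()
smallTail-star⁻ true  (suc zero) ()
smallTail-star⁻ true  (suc (suc zero)) ()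

glue : List ℕ × Bool × Fin 3 → List ℕ
glue (l , b , k) = l ++ smallTail b k

sum-glue : ∀ l b k → sum (glue (l , b , k)) ≡ sum (glue (l , b , zero)) + toℕ k
sum-glue l b k = additive-++-shift sum sum-++ l (smallTail-sum b k)

mStat-glue : ∀ l b k → mStat (glue (l , b , k)) ≡ mStat (glue (l , b , zero)) + toℕ k
mStat-glue l b k = additive-++-shift mStat mStat-++ l (smallTail-mStat b k)

star-glue : ∀ {l} b → Big l → Star (glue (l , b , zero))
star-glue {l} b big = from (Star-++ l _) (star-big big , smallTail-star b)

star-glue⁻ : ∀ l b k → Star (glue (l , b , k)) → k ≡ zero
star-glue⁻ l b k st = smallTail-star⁻ b k (proj₂ (to (Star-++ l _) st))

schur-glue-unshift : ∀ l b k → Schur (glue (l , b , k)) → Schur (glue (l , b , zero))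
schur-glue-unshift l false zero h = h
schur-glue-unshift l false (suc zero) h = subst Schur (sym (++-identityʳ l)) (schur-++⁻ˡ l h)
schur-glue-unshift l false (suc (suc zero)) h = subst Schur (sym (++-identityʳ l)) (schur-++⁻ˡ l h)
schur-glue-unshift l true zero h = h
schur-glue-unshift l true (suc zero) h = schur-∷ʳ-replace l goodPair-4⇒3 _ h
schur-glue-unshift l true (suc (suc zero)) h =
  schur-∷ʳ-replace l goodPair-4⇒3 _ (schur-++⁻ˡ (l ∷ʳ 4) (subst Schur (sym (++-assoc l _ _)) h))

schur-glue-shift : ∀ l b k → Big l → Schur (glue (l , b , zero)) → Schur (glue (l , b , k))
schur-glue-shift l false zero _ h = h
schur-glue-shift l false (suc zero) big h =
  schur-∷ʳ l (λ 5≤z → goodPair-wide 5≤z) _ big (subst Schur (++-identityʳ l) h)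
schur-glue-shift l false (suc (suc zero)) big h =
  schur-∷ʳ l (λ 5≤z → goodPair-nonMult3 refl 5≤z) _ big (subst Schur (++-identityʳ l) h)
schur-glue-shift l true zero _ h = h
schur-glue-shift l true (suc zero) _ h = schur-∷ʳ-replace l goodPair-3⇒4 _ h
schur-glue-shift l true (suc (suc zero)) _ h =
  schur-∷ʳ-∷ l (schur-∷ʳ-replace l goodPair-3⇒4 _ h) (link _ _ [ _ ])

schur-glue-reshift : ∀ l b k k′ → Big l → Schur (glue (l , b , k)) → Schur (glue (l , b , k′))
schur-glue-reshift l b k k′ big h = schur-glue-shift l b k′ big (schur-glue-unshift l b k h)

data Glued : List ℕ → Set where
  glued : ∀ {l} → Big l → ∀ b k → Glued (glue (l , b , k))

glued-small : ∀ {x r} → Schur (x ∷ r) → ¬ 5 ≤ x → Glued (x ∷ r)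
glued-small {0} h _ with () ← schur-head h
glued-small {_} {0 ∷ _} h _ with () ← schur-head (schur-∷⁻ h)
glued-small {1} {[]} _ _ = glued [] false (suc zero)
glued-small {2} {[]} _ _ = glued [] false (suc (suc zero))
glued-small {3} {[]} _ _ = glued [] true zero
glued-small {4} {[]} _ _ = glued [] true (suc zero)
glued-small {4} {1 ∷ []} _ _ = glued [] true (suc (suc zero))
glued-small {4} {1 ∷ _ ∷ _} h _ with s≤s () ← schur-gap (schur-∷⁻ h)
glued-small {1} {suc _ ∷ _} h _ with s≤s () ← schur-gap h
glued-small {2} {suc _ ∷ _} h _ with s≤s (s≤s ()) ← schur-gap h
glued-small {3} {suc _ ∷ _} h _ with s≤s (s≤s (s≤s ())) ← schur-gap h
glued-small {4} {suc (suc _) ∷ _} h _ with s≤s (s≤s (s≤s (s≤s ()))) ← schur-gap h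
glued-small {suc (suc (suc (suc (suc _))))} _ 5≰x = contradiction (s≤s (s≤s (s≤s (s≤s (s≤s z≤n))))) 5≰x

glued-schur : ∀ {π} → Schur π → Glued π
glued-schur [] = glued [] false zero
glued-schur {x ∷ r} h with 5 ≤? x
... | no 5≰x = glued-small h 5≰x
... | yes 5≤x with glued-schur (schur-∷⁻ h)
...   | glued big b k = glued (5≤x ∷ big) b k

smallTailOf : List ℕ → Bool × Fin 3
smallTailOf (1 ∷ _)     = false , suc zero
smallTailOf (2 ∷ _)     = false , suc (suc zero)
smallTailOf (3 ∷ _)     = true , zero
smallTailOf (4 ∷ [])    = true , suc zero
smallTailOf (4 ∷ _ ∷ _) = true , suc (suc zero)
smallTailOf _           = false , zero

decompose : List ℕ → List ℕ × Bool × Fin 3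
decompose [] = [] , false , zero
decompose (x ∷ r) with 5 ≤? x
... | yes _ = map₁ (x ∷_) (decompose r)
... | no _  = [] , smallTailOf (x ∷ r)

decompose-glue : ∀ {l} → Big l → ∀ b k → decompose (glue (l , b , k)) ≡ (l , b , k)
decompose-glue [] false zero             = refl
decompose-glue [] false (suc zero)       = refl
decompose-glue [] false (suc (suc zero)) = refl
decompose-glue [] true  zero             = refl
decompose-glue [] true  (suc zero)       = refl
decompose-glue [] true  (suc (suc zero)) = refl
decompose-glue {x ∷ _} (5≤x ∷ big) b k with 5 ≤? x
... | yes _   = cong (map₁ (x ∷_)) (decompose-glue big b k)
... | no 5≰x = contradiction 5≤x 5≰x

-- G π, paired with the k for which G π lies in D*(m - k, n - k).
toStar : List ℕ → Fin 3 × List ℕ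
toStar π = let (l , b , k) = decompose π in k , glue (l , b , zero)

fromStar : Fin 3 × List ℕ → List ℕ
fromStar (k , σ) = let (l , b , _) = decompose σ in glue (l , b , k)

toStar-glue : ∀ {l} → Big l → ∀ b k → toStar (glue (l , b , k)) ≡ (k , glue (l , b , zero))
toStar-glue big b k rewrite decompose-glue big b k = refl

fromStar-glue : ∀ {l} → Big l → ∀ b k k′ → fromStar (k′ , glue (l , b , k)) ≡ glue (l , b , k′)
fromStar-glue big b k k′ rewrite decompose-glue big b k = refl

toStar-valid : ∀ {π} → Schur π →
  let (k , σ) = toStar π in Schur σ × Star σ × sum π ≡ sum σ + toℕ k × mStat π ≡ mStat σ + toℕ k
toStar-valid h with glued-schur h
... | glued {l} big b k rewrite decompose-glue big b k =
  schur-glue-reshift l b k zero big h , star-glue b big , sum-glue l b k , mStat-glue l b k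

fromStar-valid : ∀ {σ} k → Schur σ → Star σ →
  let π = fromStar (k , σ) in Schur π × sum π ≡ sum σ + toℕ k × mStat π ≡ mStat σ + toℕ k
fromStar-valid k h st with glued-schur h
... | glued {l} big b k₀ with refl ← star-glue⁻ l b k₀ st rewrite decompose-glue big b zero =
  schur-glue-reshift l b zero k big h , sum-glue l b k , mStat-glue l b k

fromStar-toStar : ∀ {π} → Schur π → fromStar (toStar π) ≡ π
fromStar-toStar h with glued-schur h
... | glued big b k = trans (cong fromStar (toStar-glue big b k)) (fromStar-glue big b zero k)

toStar-fromStar : ∀ {σ} k → Schur σ → Star σ → toStar (fromStar (k , σ)) ≡ (k , σ)
toStar-fromStar k h st with glued-schur h
... | glued {l} big b k₀ with refl ← star-glue⁻ l b k₀ st =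
  trans (cong toStar (fromStar-glue big b zero k)) (toStar-glue big b k)

-- The k-th summand D*(m - k, n - k) of the target, with k added instead of subtracted.
Shifted : ℕ → ℕ → Fin 3 × List ℕ → Set
Shifted m n (k , σ) = T (isSchur σ) × Star σ × sum σ + toℕ k ≡ n × mStat σ + toℕ k ≡ m

Shifted-irrelevant : ∀ {m n} p → Irrelevant (Shifted m n p)
Shifted-irrelevant _ = T-irrelevant ×-irrelevant T-irrelevant ×-irrelevant ≡-irrelevant ×-irrelevant ≡-irrelevant

D↔Shifted : ∀ m n → D m n ↔ Σ (Fin 3 × List ℕ) (Shifted m n)
D↔Shifted m n = Σ-restrict-↔
  (λ _ → T-irrelevant ×-irrelevant ≡-irrelevant ×-irrelevant ≡-irrelevant) Shifted-irrelevant
  toStar fromStar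
  (λ {π} (h , s , μ) → let (hσ , st , s′ , μ′) = toStar-valid (isSchur⇒Schur π h)
                       in Schur⇒isSchur hσ , st , trans (sym s′) s , trans (sym μ′) μ)
  (λ {(k , σ)} (h , st , s , μ) → let (hπ , s′ , μ′) = fromStar-valid k (isSchur⇒Schur σ h) st
                                  in Schur⇒isSchur hπ , trans s′ s , trans μ′ μ)
  (λ {π} (h , _) → fromStar-toStar (isSchur⇒Schur π h))
  (λ {(k , σ)} (h , st , _) → toStar-fromStar k (isSchur⇒Schur σ h) st)

Shifted⇔D* : ∀ {m n} σ → Shifted m n (zero , σ) ⇔ (T (isSchur σ) × Star σ × sum σ ≡ n × mStat σ ≡ m)
Shifted⇔D* σ = mk⇔
  (λ (h , st , s , μ) → h , st , trans (sym (+-identityʳ _)) s , trans (sym (+-identityʳ _)) μ)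
  (λ (h , st , s , μ) → h , st , trans (+-identityʳ _) s , trans (+-identityʳ _) μ)

Shifted⇔D*shift : ∀ {m n} k σ → Shifted m n (k , σ) ⇔
  (T (toℕ k ≤ᵇ m) × T (toℕ k ≤ᵇ n) × T (isSchur σ) × Star σ × sum σ ≡ n ∸ toℕ k × mStat σ ≡ m ∸ toℕ k)
Shifted⇔D*shift k σ = mk⇔
  (λ (h , st , s , μ) → let (k≤n , s′) = to +-≡⇔≡∸ s ; (k≤m , μ′) = to +-≡⇔≡∸ μ
                        in k≤m , k≤n , h , st , s′ , μ′)
  (λ (k≤m , k≤n , h , st , s′ , μ′) → h , st , from +-≡⇔≡∸ (k≤n , s′) , from +-≡⇔≡∸ (k≤m , μ′))

Shifted↔Target : ∀ m n → Σ (Fin 3 × List ℕ) (Shifted m n) ↔ Target m n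
Shifted↔Target m n = ↔-trans Σ-Fin3-↔
  (Σ-cong-⇔ (λ σ → Shifted-irrelevant (zero , σ)) D*-irrelevant Shifted⇔D*
   ⊎-↔ Σ-cong-⇔ (λ σ → Shifted-irrelevant (suc zero , σ)) D*shift-irrelevant (Shifted⇔D*shift (suc zero))
   ⊎-↔ Σ-cong-⇔ (λ σ → Shifted-irrelevant (suc (suc zero) , σ)) D*shift-irrelevant (Shifted⇔D*shift (suc (suc zero))))
  where
  D*-irrelevant : ∀ σ → Irrelevant (T (isSchur σ) × Star σ × sum σ ≡ n × mStat σ ≡ m)
  D*-irrelevant _ = T-irrelevant ×-irrelevant T-irrelevant ×-irrelevant ≡-irrelevant ×-irrelevant ≡-irrelevant
  D*shift-irrelevant : ∀ {k} σ → Irrelevant (T (k ≤ᵇ m) × T (k ≤ᵇ n) × T (isSchur σ) × Star σ × sum σ ≡ n ∸ k × mStat σ ≡ m ∸ k)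
  D*shift-irrelevant _ = T-irrelevant ×-irrelevant T-irrelevant ×-irrelevant T-irrelevant ×-irrelevant T-irrelevant
           ×-irrelevant ≡-irrelevant ×-irrelevant ≡-irrelevant

lemma1 : (m n : ℕ) → D m n ⤖ Target m n
lemma1 m n = ↔⇒⤖ (↔-trans (D↔Shifted m n) (Shifted↔Target m n))
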